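{- Let $R$ be a finite group and let $M$ be a subgroup of $R$ with $|R:M|=2$. Suppose that $M$ contains an abelian subgroup $Z$ with $|M:Z|=2$ and that there exists $a\in R\setminus M$ with $a^2\ne 1$, $a^2\in Z\cap Z(R)$ and $z^a=z^{ -1}$ for every $z\in Z$. Then there exists a non-identity automorphism $\varphi$ of $R$ with $g^\varphi\in\{g,g^{ -1}\}$ for every $g\in R\setminus M$.
   Context: $Z(R)$ denotes the center of $R$. -}

module Defs where

open import Level using (Level; _⊔_; suc)
open import Data.Nat using (ℕ; _*_)
open import Data.Fin using (Fin)
open import Data.Product using (Σ; _×_; _,_; ∃; ∃-syntax)
open import Data.Sum using (_⊎_)
open import Data.Unit using (⊤)
open import Relation.Nullary using (¬_)
open import Relation.Binary.PropositionalEquality using (_≡_)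
open import Algebra.Bundles using (Group)

module _ {c ℓ : Level} (G : Group c ℓ) where
  open Group G

  HasSize : {p : Level} → (Carrier → Set p) → ℕ → Set (c ⊔ ℓ ⊔ p)
  HasSize P k =
    Σ (Fin k → Carrier) λ f →
      (∀ i → P (f i)) ×
      (∀ i j → f i ≈ f j → i ≡ j) ×
      (∀ x → P x → ∃[ i ] (f i ≈ x))

  Order : ℕ → Set (c ⊔ ℓ)
  Order n = HasSize {Level.zero} (λ _ → ⊤) n

  IsFinite : Set (c ⊔ ℓ)
  IsFinite = ∃[ n ] Order n

  record Subgroup (p : Level) : Set (c ⊔ ℓ ⊔ suc p) where
    field
      mem      : Carrier → Set p
      resp     : ∀ {x y} → x ≈ y → mem x → mem y
      ε-mem    : mem ε
      ∙-mem    : ∀ {x y} → mem x → mem y → mem (x ∙ y)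
      ⁻¹-mem   : ∀ {x} → mem x → mem (x ⁻¹)

  open Subgroup public

  _⊆_ : {p q : Level} → Subgroup p → Subgroup q → Set (c ⊔ p ⊔ q)
  H ⊆ K = ∀ {x} → mem H x → mem K x

  Index : {p q : Level} → Subgroup p → Subgroup q → ℕ → Set (c ⊔ ℓ ⊔ p ⊔ q)
  Index K H m = ∃[ h ] (HasSize (mem H) h × HasSize (mem K) (m * h))

  IndexInG : {p : Level} → Subgroup p → ℕ → Set (c ⊔ ℓ ⊔ p)
  IndexInG H m = ∃[ h ] (HasSize (mem H) h × Order (m * h))

  IsAbelianSub : {p : Level} → Subgroup p → Set (c ⊔ ℓ ⊔ p)
  IsAbelianSub H = ∀ {x y} → mem H x → mem H y → (x ∙ y) ≈ (y ∙ x)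

  InCenter : Carrier → Set (c ⊔ ℓ)
  InCenter x = ∀ g → (x ∙ g) ≈ (g ∙ x)

  _^_ : Carrier → Carrier → Carrier
  z ^ a = (a ⁻¹ ∙ z) ∙ a

  record IsAutomorphism (φ : Carrier → Carrier) : Set (c ⊔ ℓ) where
    field
      cong      : ∀ {x y} → x ≈ y → φ x ≈ φ y
      homo      : ∀ x y → φ (x ∙ y) ≈ (φ x ∙ φ y)
      injective : ∀ {x y} → φ x ≈ φ y → x ≈ y
      surjective : ∀ y → ∃[ x ] (φ x ≈ y)

-- Put c = a². Conjugation by a fixes c and inverts it, so c is a central involution.
-- For a subgroup N of index 2 containing c, the map fixing N and multiplying the
-- other coset by c is an automorphism. Apply this to N = M and to the second index-2
-- subgroup Z ∪ aZ above Z, and compose: on R ∖ M the composite fixes a(M ∖ Z) and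
-- multiplies aZ by c, which inverts there because (az)² = a² z^a z = c. It moves a.
module Submission where

open import Defs
open import Level using (Level; _⊔_)
open import Algebra.Bundles using (Group)
import Algebra.Properties.Group as GroupProperties
open import Data.Empty using (⊥-elim)
open import Data.Fin using (Fin; zero; suc; remQuot)
open import Data.Fin.Properties using (_≟_; any?; *↔×; injective⇒≤)
open import Data.Nat using (suc; _*_; _≤_)
import Data.Nat.Properties as ℕ
open import Data.Product using (Σ; _×_; _,_; proj₁; proj₂)
open import Data.Sum using (_⊎_; inj₁; inj₂)
open import Data.Unit using (⊤; tt)
open import Function using (_∘_)
open import Function.Bundles using (Injection)
open import Function.Properties.Inverse using (↔⇒↣)
open import Relation.Nullary using (¬_; Dec; yes; no)
import Relation.Binary.PropositionalEquality as ≡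
open ≡ using (_≡_)
import Relation.Binary.Reasoning.Setoid as SetoidReasoning

module _ {c ℓ : Level} (G : Group c ℓ) where
  open Group G
  open GroupProperties G
  open SetoidReasoning setoid

  ≈-dec : IsFinite G → ∀ x y → Dec (x ≈ y)
  ≈-dec (_ , enum , _ , enum-injective , enum-onto) x y
    with enum-onto x tt | enum-onto y tt
  ... | i , eᵢ≈x | j , eⱼ≈y with i ≟ j
  ... | yes ≡.refl = yes (trans (sym eᵢ≈x) eⱼ≈y)
  ... | no i≢j = no λ x≈y → i≢j (enum-injective i j (trans eᵢ≈x (trans x≈y (sym eⱼ≈y))))

  HasSize⇒dec : ∀ {p} {P : Carrier → Set p} {k} → IsFinite G →
    (∀ {x y} → x ≈ y → P x → P y) → HasSize G P k → ∀ x → Dec (P x)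
  HasSize⇒dec finite P-resp (enum , enum∈P , _ , enum-onto) x
    with any? (λ i → ≈-dec finite (enum i) x)
  ... | yes (i , eᵢ≈x) = yes (P-resp eᵢ≈x (enum∈P i))
  ... | no ∄i = no λ x∈P → ∄i (enum-onto x x∈P)

  HasSize-injection⇒≤ : ∀ {p} {P : Carrier → Set p} {k m} → HasSize G P k →
    (e : Fin m → Carrier) → (∀ i → P (e i)) → (∀ i j → e i ≈ e j → i ≡ j) → m ≤ k
  HasSize-injection⇒≤ {m = m} (enum , _ , _ , enum-onto) e e∈P e-injective =
    injective⇒≤ position-injective
    where
    position : Fin m → Fin _
    position i = proj₁ (enum-onto (e i) (e∈P i))

    position-injective : ∀ {i j} → position i ≡ position j → i ≡ j
    position-injective {i} {j} eq = e-injective i j (begin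
      e i               ≈⟨ sym (proj₂ (enum-onto (e i) (e∈P i))) ⟩
      enum (position i) ≡⟨ ≡.cong enum eq ⟩
      enum (position j) ≈⟨ proj₂ (enum-onto (e j) (e∈P j)) ⟩
      e j               ∎)

  x∙u≈y∙v⇒y⁻¹∙x≈v∙u⁻¹ : ∀ {x y u v} → x ∙ u ≈ y ∙ v → y ⁻¹ ∙ x ≈ v ∙ u ⁻¹
  x∙u≈y∙v⇒y⁻¹∙x≈v∙u⁻¹ {x} {y} {u} {v} eq = begin
    y ⁻¹ ∙ x               ≈⟨ //-rightDividesʳ u (y ⁻¹ ∙ x) ⟨
    (y ⁻¹ ∙ x) ∙ u ∙ u ⁻¹  ≈⟨ ∙-congʳ (assoc (y ⁻¹) x u) ⟩
    y ⁻¹ ∙ (x ∙ u) ∙ u ⁻¹  ≈⟨ ∙-congʳ (∙-congˡ eq) ⟩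
    y ⁻¹ ∙ (y ∙ v) ∙ u ⁻¹  ≈⟨ ∙-congʳ (\\-leftDividesʳ y v) ⟩
    v ∙ u ⁻¹               ∎

  whole : Subgroup G Level.zero
  whole = record
    { mem = λ _ → ⊤ ; resp = λ _ _ → tt ; ε-mem = tt ; ∙-mem = λ _ _ → tt ; ⁻¹-mem = λ _ → tt }

  module _ {p} (N : Subgroup G p) where

    ∉⇒⁻¹∉ : ∀ {x} → ¬ mem N x → ¬ mem N (x ⁻¹)
    ∉⇒⁻¹∉ {x} x∉N x⁻¹∈N = x∉N (resp N (⁻¹-involutive x) (⁻¹-mem N x⁻¹∈N))

    ∈∙∉⇒∉ : ∀ {x y} → mem N x → ¬ mem N y → ¬ mem N (x ∙ y)
    ∈∙∉⇒∉ {x} {y} x∈N y∉N xy∈N =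
      y∉N (resp N (\\-leftDividesʳ x y) (∙-mem N (⁻¹-mem N x∈N) xy∈N))

    ∉∙∈⇒∉ : ∀ {x y} → ¬ mem N x → mem N y → ¬ mem N (x ∙ y)
    ∉∙∈⇒∉ {x} {y} x∉N y∈N xy∈N =
      x∉N (resp N (//-rightDividesʳ y x) (∙-mem N xy∈N (⁻¹-mem N y∈N)))

    \\-mem-sym : ∀ {x y} → mem N (x ⁻¹ ∙ y) → mem N (y ⁻¹ ∙ x)
    \\-mem-sym {x} {y} x⁻¹y∈N = resp N (⁻¹-anti-homo-\\ x y) (⁻¹-mem N x⁻¹y∈N)

    ε\\-mem : ∀ {x} → mem N (ε ⁻¹ ∙ x) → mem N x
    ε\\-mem {x} ε⁻¹x∈N = resp N (\\-leftDividesˡ ε x) (∙-mem N (ε-mem N) ε⁻¹x∈N)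

    ComplementClosed : Set (c ⊔ p)
    ComplementClosed = ∀ {x y} → ¬ mem N x → ¬ mem N y → mem N (x ∙ y)

    complementClosed⇒conj-mem : ComplementClosed →
      ∀ {a m} → ¬ mem N a → mem N m → mem N (a ⁻¹ ∙ m ∙ a)
    complementClosed⇒conj-mem closed a∉N m∈N = closed (∉∙∈⇒∉ (∉⇒⁻¹∉ a∉N) m∈N) a∉N

  module _ {p q} {H : Subgroup G p} {K : Subgroup G q} (H⊆K : _⊆_ G H K) where

    distinct-cosets⇒≤ : ∀ {h k n} → HasSize G (mem H) h → HasSize G (mem K) k →
      (r : Fin n → Carrier) → (∀ i → mem K (r i)) →
      (∀ i j → mem H (r j ⁻¹ ∙ r i) → i ≡ j) → n * h ≤ k
    distinct-cosets⇒≤ {h} {n = n} (f , f∈H , f-injective , _) sK r r∈K r-distinct =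
      HasSize-injection⇒≤ sK (coset ∘ remQuot h) (coset∈K ∘ remQuot h)
        λ i j eq → Injection.injective (↔⇒↣ (*↔× {n} {h})) (coset-injective _ _ eq)
      where
      coset : Fin n × Fin h → Carrier
      coset (i , j) = r i ∙ f j

      coset∈K : ∀ s → mem K (coset s)
      coset∈K (i , j) = ∙-mem K (r∈K i) (H⊆K (f∈H j))

      coset-injective : ∀ s t → coset s ≈ coset t → s ≡ t
      coset-injective (i , j) (i′ , j′) eq
        with r-distinct i i′ (resp H (sym (x∙u≈y∙v⇒y⁻¹∙x≈v∙u⁻¹ eq))
                                     (∙-mem H (f∈H j′) (⁻¹-mem H (f∈H j))))
      ... | ≡.refl = ≡.cong (i ,_) (f-injective j j′ (∙-cancelˡ (r i) (f j) (f j′) eq))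

    index-2⇒same-coset : IsFinite G → Index G K H 2 →
      ∀ {u v} → mem K u → mem K v → ¬ mem H u → ¬ mem H v → mem H (v ⁻¹ ∙ u)
    index-2⇒same-coset finite (h , sH , sK) {u} {v} u∈K v∈K u∉H v∉H
      with HasSize⇒dec finite (resp H) sH (v ⁻¹ ∙ u)
    ... | yes v⁻¹u∈H = v⁻¹u∈H
    ... | no v⁻¹u∉H = ⊥-elim (3h≰2h index-of-ε (distinct-cosets⇒≤ sH sK r r∈K r-distinct))
      where
      index-of-ε : Fin h
      index-of-ε = proj₁ (proj₂ (proj₂ (proj₂ sH)) ε (ε-mem H))

      3h≰2h : ∀ {n} → Fin n → ¬ (3 * n ≤ 2 * n)
      3h≰2h {suc n} _ = ℕ.<⇒≱ (ℕ.*-monoˡ-< (suc n) (ℕ.n<1+n 2))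

      r : Fin 3 → Carrier
      r zero = ε
      r (suc zero) = u
      r (suc (suc zero)) = v

      r∈K : ∀ i → mem K (r i)
      r∈K zero = ε-mem K
      r∈K (suc zero) = u∈K
      r∈K (suc (suc zero)) = v∈K

      r-distinct : ∀ i j → mem H (r j ⁻¹ ∙ r i) → i ≡ j
      r-distinct zero zero _ = ≡.refl
      r-distinct (suc zero) (suc zero) _ = ≡.refl
      r-distinct (suc (suc zero)) (suc (suc zero)) _ = ≡.refl
      r-distinct (suc zero) zero ε~u = ⊥-elim (u∉H (ε\\-mem H ε~u))
      r-distinct (suc (suc zero)) zero ε~v = ⊥-elim (v∉H (ε\\-mem H ε~v))
      r-distinct zero (suc zero) u~ε = ⊥-elim (u∉H (ε\\-mem H (\\-mem-sym H u~ε)))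
      r-distinct zero (suc (suc zero)) v~ε = ⊥-elim (v∉H (ε\\-mem H (\\-mem-sym H v~ε)))
      r-distinct (suc zero) (suc (suc zero)) v~u = ⊥-elim (v⁻¹u∉H v~u)
      r-distinct (suc (suc zero)) (suc zero) u~v = ⊥-elim (v⁻¹u∉H (\\-mem-sym H u~v))

    index-2⇒∙-mem : IsFinite G → Index G K H 2 →
      ∀ {x y} → mem K x → mem K y → ¬ mem H x → ¬ mem H y → mem H (x ∙ y)
    index-2⇒∙-mem finite index {x} {y} x∈K y∈K x∉H y∉H =
      resp H (∙-congʳ (⁻¹-involutive x))
        (index-2⇒same-coset finite index y∈K (⁻¹-mem K x∈K) y∉H (∉⇒⁻¹∉ H x∉H))

  module Twist {p} (N : Subgroup G p) (N? : ∀ x → Dec (mem N x)) (closed : ComplementClosed N)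
    {k} (k∈N : mem N k) (k∙k≈ε : k ∙ k ≈ ε) (k-central : InCenter G k) where

    twist : Carrier → Carrier
    twist x with N? x
    ... | yes _ = x
    ... | no _ = x ∙ k

    twist-∈ : ∀ {x} → mem N x → twist x ≈ x
    twist-∈ {x} x∈N with N? x
    ... | yes _ = refl
    ... | no x∉N = ⊥-elim (x∉N x∈N)

    twist-∉ : ∀ {x} → ¬ mem N x → twist x ≈ x ∙ k
    twist-∉ {x} x∉N with N? x
    ... | yes x∈N = ⊥-elim (x∉N x∈N)
    ... | no _ = refl

    x∙k∙k≈x : ∀ x → x ∙ k ∙ k ≈ x
    x∙k∙k≈x x = trans (assoc x k k) (trans (∙-congˡ k∙k≈ε) (identityʳ x))

    twist-cong : ∀ {x y} → x ≈ y → twist x ≈ twist y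
    twist-cong {x} {y} x≈y = by-cases (N? x)
      where
      by-cases : Dec (mem N x) → twist x ≈ twist y
      by-cases (yes x∈N) = trans (twist-∈ x∈N) (trans x≈y (sym (twist-∈ (resp N x≈y x∈N))))
      by-cases (no x∉N) = trans (twist-∉ x∉N)
                              (trans (∙-congʳ x≈y) (sym (twist-∉ (x∉N ∘ resp N (sym x≈y)))))

    twist-homo : ∀ x y → twist (x ∙ y) ≈ twist x ∙ twist y
    twist-homo x y = by-cases (N? x) (N? y)
      where
      by-cases : Dec (mem N x) → Dec (mem N y) → twist (x ∙ y) ≈ twist x ∙ twist y
      by-cases (yes x∈N) (yes y∈N) = begin
        twist (x ∙ y)       ≈⟨ twist-∈ (∙-mem N x∈N y∈N) ⟩
        x ∙ y               ≈⟨ ∙-cong (twist-∈ x∈N) (twist-∈ y∈N) ⟨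
        twist x ∙ twist y   ∎
      by-cases (yes x∈N) (no y∉N) = begin
        twist (x ∙ y)       ≈⟨ twist-∉ (∈∙∉⇒∉ N x∈N y∉N) ⟩
        x ∙ y ∙ k           ≈⟨ assoc x y k ⟩
        x ∙ (y ∙ k)         ≈⟨ ∙-cong (twist-∈ x∈N) (twist-∉ y∉N) ⟨
        twist x ∙ twist y   ∎
      by-cases (no x∉N) (yes y∈N) = begin
        twist (x ∙ y)       ≈⟨ twist-∉ (∉∙∈⇒∉ N x∉N y∈N) ⟩
        x ∙ y ∙ k           ≈⟨ assoc x y k ⟩
        x ∙ (y ∙ k)         ≈⟨ ∙-congˡ (k-central y) ⟨
        x ∙ (k ∙ y)         ≈⟨ assoc x k y ⟨
        x ∙ k ∙ y           ≈⟨ ∙-cong (twist-∉ x∉N) (twist-∈ y∈N) ⟨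
        twist x ∙ twist y   ∎
      by-cases (no x∉N) (no y∉N) = begin
        twist (x ∙ y)       ≈⟨ twist-∈ (closed x∉N y∉N) ⟩
        x ∙ y               ≈⟨ ∙-congʳ (x∙k∙k≈x x) ⟨
        x ∙ k ∙ k ∙ y       ≈⟨ assoc (x ∙ k) k y ⟩
        x ∙ k ∙ (k ∙ y)     ≈⟨ ∙-congˡ (k-central y) ⟩
        x ∙ k ∙ (y ∙ k)     ≈⟨ ∙-cong (twist-∉ x∉N) (twist-∉ y∉N) ⟨
        twist x ∙ twist y   ∎

    twist-involutive : ∀ x → twist (twist x) ≈ x
    twist-involutive x = by-cases (N? x)
      where
      by-cases : Dec (mem N x) → twist (twist x) ≈ x
      by-cases (yes x∈N) = trans (twist-cong (twist-∈ x∈N)) (twist-∈ x∈N)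
      by-cases (no x∉N) = begin
        twist (twist x)  ≈⟨ twist-cong (twist-∉ x∉N) ⟩
        twist (x ∙ k)    ≈⟨ twist-∉ (∉∙∈⇒∉ N x∉N k∈N) ⟩
        x ∙ k ∙ k        ≈⟨ x∙k∙k≈x x ⟩
        x                ∎

    twist-isAutomorphism : IsAutomorphism G twist
    twist-isAutomorphism = record
      { cong       = twist-cong
      ; homo       = twist-homo
      ; injective  = λ {x} {y} eq →
          trans (sym (twist-involutive x)) (trans (twist-cong eq) (twist-involutive y))
      ; surjective = λ y → twist y , twist-involutive y
      }

  IsAutomorphism-∘ : ∀ {f g} → IsAutomorphism G f → IsAutomorphism G g →
    IsAutomorphism G (f ∘ g)
  IsAutomorphism-∘ {f} {g} F H = record
    { cong       = F.cong ∘ H.cong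
    ; homo       = λ x y → trans (F.cong (H.homo x y)) (F.homo (g x) (g y))
    ; injective  = H.injective ∘ F.injective
    ; surjective = λ z → let (y , fy≈z) = F.surjective z
                             (x , gx≈y) = H.surjective y
                         in x , trans (F.cong gx≈y) fy≈z
    }
    where
    module F = IsAutomorphism F
    module H = IsAutomorphism H

  g∙g≈k⇒g∙k≈g⁻¹ : ∀ {g k} → k ∙ k ≈ ε → g ∙ g ≈ k → g ∙ k ≈ g ⁻¹
  g∙g≈k⇒g∙k≈g⁻¹ {g} {k} k∙k≈ε g∙g≈k = begin
    g ∙ k                    ≈⟨ ∙-congʳ (\\-leftDividesʳ g g) ⟨
    g ⁻¹ ∙ (g ∙ g) ∙ k       ≈⟨ assoc (g ⁻¹) (g ∙ g) k ⟩
    g ⁻¹ ∙ (g ∙ g ∙ k)       ≈⟨ ∙-congˡ (∙-congʳ g∙g≈k) ⟩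
    g ⁻¹ ∙ (k ∙ k)           ≈⟨ ∙-congˡ k∙k≈ε ⟩
    g ⁻¹ ∙ ε                 ≈⟨ identityʳ (g ⁻¹) ⟩
    g ⁻¹                     ∎

  module _ (a : Carrier) where

    a⁻¹[gh]≈gᵃ[a⁻¹h] : ∀ g h → a ⁻¹ ∙ (g ∙ h) ≈ a ⁻¹ ∙ g ∙ a ∙ (a ⁻¹ ∙ h)
    a⁻¹[gh]≈gᵃ[a⁻¹h] g h = begin
      a ⁻¹ ∙ (g ∙ h)                ≈⟨ assoc (a ⁻¹) g h ⟨
      a ⁻¹ ∙ g ∙ h                  ≈⟨ ∙-congˡ (\\-leftDividesˡ a h) ⟨
      a ⁻¹ ∙ g ∙ (a ∙ (a ⁻¹ ∙ h))   ≈⟨ assoc (a ⁻¹ ∙ g) a (a ⁻¹ ∙ h) ⟨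
      a ⁻¹ ∙ g ∙ a ∙ (a ⁻¹ ∙ h)     ∎

    gh≈a²[a⁻¹g]ᵃ[a⁻¹h] : ∀ g h → g ∙ h ≈ a ∙ a ∙ (a ⁻¹ ∙ (a ⁻¹ ∙ g) ∙ a ∙ (a ⁻¹ ∙ h))
    gh≈a²[a⁻¹g]ᵃ[a⁻¹h] g h = begin
      g ∙ h                                       ≈⟨ \\-leftDividesˡ a (g ∙ h) ⟨
      a ∙ (a ⁻¹ ∙ (g ∙ h))                        ≈⟨ ∙-congˡ (assoc (a ⁻¹) g h) ⟨
      a ∙ (a ⁻¹ ∙ g ∙ h)                          ≈⟨ ∙-congˡ (\\-leftDividesˡ a _) ⟨
      a ∙ (a ∙ (a ⁻¹ ∙ (a ⁻¹ ∙ g ∙ h)))           ≈⟨ assoc a a _ ⟨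
      a ∙ a ∙ (a ⁻¹ ∙ (a ⁻¹ ∙ g ∙ h))             ≈⟨ ∙-congˡ (a⁻¹[gh]≈gᵃ[a⁻¹h] (a ⁻¹ ∙ g) h) ⟩
      a ∙ a ∙ (a ⁻¹ ∙ (a ⁻¹ ∙ g) ∙ a ∙ (a ⁻¹ ∙ h)) ∎

    a⁻¹g⁻¹≈[a⁻¹g]⁻¹ᵃa⁻² : ∀ g → a ⁻¹ ∙ g ⁻¹ ≈ a ⁻¹ ∙ (a ⁻¹ ∙ g) ⁻¹ ∙ a ∙ (a ∙ a) ⁻¹
    a⁻¹g⁻¹≈[a⁻¹g]⁻¹ᵃa⁻² g = begin
      a ⁻¹ ∙ g ⁻¹                                ≈⟨ ∙-congˡ (//-rightDividesˡ (a ⁻¹) (g ⁻¹)) ⟨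
      a ⁻¹ ∙ (g ⁻¹ ∙ a ⁻¹ ⁻¹ ∙ a ⁻¹)             ≈⟨ ∙-congˡ (∙-congʳ (⁻¹-anti-homo-∙ (a ⁻¹) g)) ⟨
      a ⁻¹ ∙ ((a ⁻¹ ∙ g) ⁻¹ ∙ a ⁻¹)              ≈⟨ a⁻¹[gh]≈gᵃ[a⁻¹h] _ _ ⟩
      a ⁻¹ ∙ (a ⁻¹ ∙ g) ⁻¹ ∙ a ∙ (a ⁻¹ ∙ a ⁻¹)   ≈⟨ ∙-congˡ (⁻¹-anti-homo-∙ a a) ⟨
      a ⁻¹ ∙ (a ⁻¹ ∙ g) ⁻¹ ∙ a ∙ (a ∙ a) ⁻¹      ∎

    a[xᵃ]a⁻¹≈x : ∀ x → a ∙ (a ⁻¹ ∙ x ∙ a) ∙ a ⁻¹ ≈ x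
    a[xᵃ]a⁻¹≈x x = begin
      a ∙ (a ⁻¹ ∙ x ∙ a) ∙ a ⁻¹  ≈⟨ ∙-congʳ (assoc a (a ⁻¹ ∙ x) a) ⟨
      a ∙ (a ⁻¹ ∙ x) ∙ a ∙ a ⁻¹  ≈⟨ //-rightDividesʳ a _ ⟩
      a ∙ (a ⁻¹ ∙ x)             ≈⟨ \\-leftDividesˡ a x ⟩
      x                          ∎

  module CosetUnion {q} (Z : Subgroup G q) (a : Carrier) (a∙a∈Z : mem Z (a ∙ a))
    (conj-mem : ∀ {z} → mem Z z → mem Z (a ⁻¹ ∙ z ∙ a)) where

    Z∪aZ : Subgroup G q
    Z∪aZ = record
      { mem    = λ x → mem Z x ⊎ mem Z (a ⁻¹ ∙ x)
      ; resp   = λ { x≈y (inj₁ x∈Z) → inj₁ (resp Z x≈y x∈Z)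
                   ; x≈y (inj₂ x∈aZ) → inj₂ (resp Z (∙-congˡ x≈y) x∈aZ) }
      ; ε-mem  = inj₁ (ε-mem Z)
      ; ∙-mem  = ∙-closed
      ; ⁻¹-mem = ⁻¹-closed
      }
      where
      ∙-closed : ∀ {g h} → mem Z g ⊎ mem Z (a ⁻¹ ∙ g) → mem Z h ⊎ mem Z (a ⁻¹ ∙ h) →
        mem Z (g ∙ h) ⊎ mem Z (a ⁻¹ ∙ (g ∙ h))
      ∙-closed (inj₁ g∈Z) (inj₁ h∈Z) = inj₁ (∙-mem Z g∈Z h∈Z)
      ∙-closed (inj₁ g∈Z) (inj₂ h∈aZ) =
        inj₂ (resp Z (sym (a⁻¹[gh]≈gᵃ[a⁻¹h] a _ _)) (∙-mem Z (conj-mem g∈Z) h∈aZ))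
      ∙-closed (inj₂ g∈aZ) (inj₁ h∈Z) = inj₂ (resp Z (assoc _ _ _) (∙-mem Z g∈aZ h∈Z))
      ∙-closed (inj₂ g∈aZ) (inj₂ h∈aZ) =
        inj₁ (resp Z (sym (gh≈a²[a⁻¹g]ᵃ[a⁻¹h] a _ _))
                 (∙-mem Z a∙a∈Z (∙-mem Z (conj-mem g∈aZ) h∈aZ)))

      ⁻¹-closed : ∀ {g} → mem Z g ⊎ mem Z (a ⁻¹ ∙ g) → mem Z (g ⁻¹) ⊎ mem Z (a ⁻¹ ∙ g ⁻¹)
      ⁻¹-closed (inj₁ g∈Z) = inj₁ (⁻¹-mem Z g∈Z)
      ⁻¹-closed (inj₂ g∈aZ) =
        inj₂ (resp Z (sym (a⁻¹g⁻¹≈[a⁻¹g]⁻¹ᵃa⁻² a _))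
                 (∙-mem Z (conj-mem (⁻¹-mem Z g∈aZ)) (⁻¹-mem Z a∙a∈Z)))

    Z∪aZ-dec : (∀ x → Dec (mem Z x)) → ∀ x → Dec (mem Z∪aZ x)
    Z∪aZ-dec Z? x with Z? x | Z? (a ⁻¹ ∙ x)
    ... | yes x∈Z | _ = yes (inj₁ x∈Z)
    ... | no _ | yes x∈aZ = yes (inj₂ x∈aZ)
    ... | no x∉Z | no x∉aZ = no λ { (inj₁ x∈Z) → x∉Z x∈Z ; (inj₂ x∈aZ) → x∉aZ x∈aZ }

    Z∪aZ-complementClosed : ∀ {p} {N : Subgroup G p} → (∀ x → Dec (mem N x)) →
      ComplementClosed N → ¬ mem N a →
      (∀ {x y} → mem N x → mem N y → ¬ mem Z x → ¬ mem Z y → mem Z (x ∙ y)) →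
      (∀ {x} → mem Z (a ⁻¹ ∙ x ∙ a) → mem Z x) →
      ComplementClosed Z∪aZ
    Z∪aZ-complementClosed {N = N} N? N-closed a∉N Z-closed-in-N conj-reflects {g} {h} g∉ h∉ =
      by-cases (N? g) (N? h)
      where
      a⁻¹∙-∉⇒∈ : ∀ {x} → ¬ mem N x → mem N (a ⁻¹ ∙ x)
      a⁻¹∙-∉⇒∈ = N-closed (∉⇒⁻¹∉ N a∉N)

      conj-N : ∀ {x} → mem N x → mem N (a ⁻¹ ∙ x ∙ a)
      conj-N = complementClosed⇒conj-mem N N-closed a∉N

      by-cases : Dec (mem N g) → Dec (mem N h) → mem Z∪aZ (g ∙ h)
      by-cases (yes g∈N) (yes h∈N) = inj₁ (Z-closed-in-N g∈N h∈N (g∉ ∘ inj₁) (h∉ ∘ inj₁))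
      by-cases (yes g∈N) (no h∉N) =
        inj₂ (resp Z (sym (a⁻¹[gh]≈gᵃ[a⁻¹h] a g h))
          (Z-closed-in-N (conj-N g∈N) (a⁻¹∙-∉⇒∈ h∉N) (g∉ ∘ inj₁ ∘ conj-reflects) (h∉ ∘ inj₂)))
      by-cases (no g∉N) (yes h∈N) =
        inj₂ (resp Z (assoc (a ⁻¹) g h) (Z-closed-in-N (a⁻¹∙-∉⇒∈ g∉N) h∈N (g∉ ∘ inj₂) (h∉ ∘ inj₁)))
      by-cases (no g∉N) (no h∉N) =
        inj₁ (resp Z (sym (gh≈a²[a⁻¹g]ᵃ[a⁻¹h] a g h)) (∙-mem Z a∙a∈Z
          (Z-closed-in-N (conj-N (a⁻¹∙-∉⇒∈ g∉N)) (a⁻¹∙-∉⇒∈ h∉N)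
                         (g∉ ∘ inj₂ ∘ conj-reflects) (h∉ ∘ inj₂))))

  module Inverting {q} (Z : Subgroup G q) (a : Carrier)
    (inverts : ∀ z → mem Z z → a ⁻¹ ∙ z ∙ a ≈ z ⁻¹) where

    conj-mem : ∀ {z} → mem Z z → mem Z (a ⁻¹ ∙ z ∙ a)
    conj-mem {z} z∈Z = resp Z (sym (inverts z z∈Z)) (⁻¹-mem Z z∈Z)

    conj-reflects : ∀ {x} → mem Z (a ⁻¹ ∙ x ∙ a) → mem Z x
    conj-reflects {x} xᵃ∈Z = resp Z (begin
      (a ⁻¹ ∙ x ∙ a) ⁻¹                         ≈⟨ a[xᵃ]a⁻¹≈x a _ ⟨
      a ∙ (a ⁻¹ ∙ (a ⁻¹ ∙ x ∙ a) ⁻¹ ∙ a) ∙ a ⁻¹ ≈⟨ ∙-congʳ (∙-congˡ (inverts _ (⁻¹-mem Z xᵃ∈Z))) ⟩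
      a ∙ (a ⁻¹ ∙ x ∙ a) ⁻¹ ⁻¹ ∙ a ⁻¹           ≈⟨ ∙-congʳ (∙-congˡ (⁻¹-involutive _)) ⟩
      a ∙ (a ⁻¹ ∙ x ∙ a) ∙ a ⁻¹                 ≈⟨ a[xᵃ]a⁻¹≈x a x ⟩
      x                                         ∎) (⁻¹-mem Z xᵃ∈Z)

    a²-involution : mem Z (a ∙ a) → a ∙ a ∙ (a ∙ a) ≈ ε
    a²-involution a²∈Z = begin
      a ∙ a ∙ (a ∙ a)                ≈⟨ ∙-congˡ (∙-congʳ (\\-leftDividesʳ a a)) ⟨
      a ∙ a ∙ (a ⁻¹ ∙ (a ∙ a) ∙ a)   ≈⟨ ∙-congˡ (inverts _ a²∈Z) ⟩
      a ∙ a ∙ (a ∙ a) ⁻¹             ≈⟨ inverseʳ (a ∙ a) ⟩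
      ε                              ∎

    aZ-square : ∀ {g} → mem Z (a ⁻¹ ∙ g) → g ∙ g ≈ a ∙ a
    aZ-square {g} g∈aZ = begin
      g ∙ g                                         ≈⟨ gh≈a²[a⁻¹g]ᵃ[a⁻¹h] a g g ⟩
      a ∙ a ∙ (a ⁻¹ ∙ (a ⁻¹ ∙ g) ∙ a ∙ (a ⁻¹ ∙ g))  ≈⟨ ∙-congˡ (∙-congʳ (inverts _ g∈aZ)) ⟩
      a ∙ a ∙ ((a ⁻¹ ∙ g) ⁻¹ ∙ (a ⁻¹ ∙ g))          ≈⟨ ∙-congˡ (inverseˡ (a ⁻¹ ∙ g)) ⟩
      a ∙ a ∙ ε                                     ≈⟨ identityʳ (a ∙ a) ⟩
      a ∙ a                                         ∎

lemma3p2 : {c ℓ p q : Level} (R : Group c ℓ) → IsFinite R →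
    (M : Subgroup R p) → IndexInG R M 2 →
    (Z : Subgroup R q) → _⊆_ R Z M → Index R M Z 2 → IsAbelianSub R Z →
    (a : Group.Carrier R) → ¬ Subgroup.mem M a →
    ¬ (Group._≈_ R (Group._∙_ R a a) (Group.ε R)) →
    Subgroup.mem Z (Group._∙_ R a a) → InCenter R (Group._∙_ R a a) →
    (∀ z → Subgroup.mem Z z → Group._≈_ R (_^_ R z a) (Group._⁻¹ R z)) →
    Σ (Group.Carrier R → Group.Carrier R) λ φ →
      IsAutomorphism R φ ×
      ¬ (∀ g → Group._≈_ R (φ g) g) ×
      (∀ g → ¬ Subgroup.mem M g →
        Group._≈_ R (φ g) g ⊎ Group._≈_ R (φ g) (Group._⁻¹ R g))
lemma3p2 R fin M M-index Z Z⊆M Z-index _ a a∉M a²≉ε a²∈Z a²-central inverts =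
  φ , IsAutomorphism-∘ R τM.twist-isAutomorphism τZ∪aZ.twist-isAutomorphism , φ-moves-a , φ-on-R∖M
  where
  open Group R
  open GroupProperties R using (∙-cancelˡ)
  open SetoidReasoning setoid
  open Inverting R Z a inverts
  open CosetUnion R Z a a²∈Z conj-mem

  M? : ∀ x → Dec (mem M x)
  M? = HasSize⇒dec R fin (resp M) (proj₁ (proj₂ M-index))

  Z? : ∀ x → Dec (mem Z x)
  Z? = HasSize⇒dec R fin (resp Z) (proj₁ (proj₂ Z-index))

  -- IndexInG R M 2 is Index R (whole R) M 2 by definition.
  M-closed : ComplementClosed R M
  M-closed = index-2⇒∙-mem R {H = M} {K = whole R} (λ _ → tt) fin M-index tt tt

  Z∪aZ-closed : ComplementClosed R Z∪aZ
  Z∪aZ-closed = Z∪aZ-complementClosed {N = M} M? M-closed a∉M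
    (index-2⇒∙-mem R {H = Z} {K = M} Z⊆M fin Z-index) conj-reflects

  module τM = Twist R M M? M-closed (Z⊆M a²∈Z) (a²-involution a²∈Z) a²-central
  module τZ∪aZ = Twist R Z∪aZ (Z∪aZ-dec Z?) Z∪aZ-closed
                   (inj₁ a²∈Z) (a²-involution a²∈Z) a²-central

  φ : Carrier → Carrier
  φ = τM.twist ∘ τZ∪aZ.twist

  φ-moves-a : ¬ (∀ g → φ g ≈ g)
  φ-moves-a fixes = a²≉ε (∙-cancelˡ a (a ∙ a) ε (begin
    a ∙ (a ∙ a)  ≈⟨ τM.twist-∉ a∉M ⟨
    τM.twist a   ≈⟨ τM.twist-cong (τZ∪aZ.twist-∈ (inj₂ (resp Z (sym (inverseˡ a)) (ε-mem Z)))) ⟨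
    φ a          ≈⟨ fixes a ⟩
    a            ≈⟨ identityʳ a ⟨
    a ∙ ε        ∎))

  φ-on-R∖M : ∀ g → ¬ mem M g → φ g ≈ g ⊎ φ g ≈ g ⁻¹
  φ-on-R∖M g g∉M = by-cases (Z∪aZ-dec Z? g)
    where
    by-cases : Dec (mem Z∪aZ g) → φ g ≈ g ⊎ φ g ≈ g ⁻¹
    by-cases (yes (inj₁ g∈Z)) = ⊥-elim (g∉M (Z⊆M g∈Z))
    by-cases (yes (inj₂ g∈aZ)) = inj₂ (begin
      φ g          ≈⟨ τM.twist-cong (τZ∪aZ.twist-∈ (inj₂ g∈aZ)) ⟩
      τM.twist g   ≈⟨ τM.twist-∉ g∉M ⟩
      g ∙ (a ∙ a)  ≈⟨ g∙g≈k⇒g∙k≈g⁻¹ R (a²-involution a²∈Z) (aZ-square g∈aZ) ⟩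
      g ⁻¹         ∎)
    by-cases (no g∉Z∪aZ) = inj₁ (begin
      φ g                     ≈⟨ τM.twist-cong (τZ∪aZ.twist-∉ g∉Z∪aZ) ⟩
      τM.twist (g ∙ (a ∙ a))  ≈⟨ τM.twist-∉ (∉∙∈⇒∉ R M g∉M (Z⊆M a²∈Z)) ⟩
      g ∙ (a ∙ a) ∙ (a ∙ a)   ≈⟨ τM.x∙k∙k≈x g ⟩
      g                       ∎)
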